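{- Let $G$ be a finite simple graph. Then $G$ is an EOCD graph with empty $D\cap P$ if and only if there exists $A\subseteq V(G)$ such that the induced subgraph $\langle A\rangle$ is isomorphic to $kP_4$ (a disjoint union of $k$ copies of the path on four vertices, for some $k$), where every vertex of $V(G)-A$ is adjacent to exactly one vertex of degree $1$ in $\langle A\rangle$ and one vertex of degree $2$ in $\langle A\rangle$.
   Context: For a vertex $v$, $N(v)$ and $N[v]=N(v)\cup\{v\}$ are its open and closed neighborhoods. A set $P\subseteq V(G)$ is an ECD set if the sets $N[v]$, $v\in P$, partition $V(G)$. A set $D\subseteq V(G)$ is an EOD set if the sets $N(v)$, $v\in D$, partition $V(G)$. $G$ is an EOCD graph if it has both an ECD set and an EOD set. $G$ is an EOCD graph with empty $D\cap P$ if there exist an ECD set $P$ and an EOD set $D$ of $G$ with $D\cap P=\emptyset$. $\langle S\rangle$ denotes the subgraph induced by $S$. -}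

module Defs where

open import Data.Nat using (ℕ; _+_)
open import Data.Bool using (Bool; true; false)
open import Data.Fin using (Fin; toℕ)
open import Data.Fin.Subset using (Subset; _∈_; _∉_; _∩_; _∪_; ⁅_⁆; ∣_∣; Empty)
open import Data.Vec using (tabulate)
open import Data.Product using (Σ; ∃; _×_)
open import Data.Sum using (_⊎_)
open import Function.Definitions using (Injective)
open import Function.Bundles using (_⇔_)
open import Relation.Binary.PropositionalEquality using (_≡_)

record Graph (n : ℕ) : Set where
  field
    adj    : Fin n → Fin n → Bool
    sym    : ∀ u v → adj u v ≡ adj v u
    irrefl : ∀ v → adj v v ≡ false
open Graph public

module _ {n : ℕ} (G : Graph n) where

  N : Fin n → Subset n
  N v = tabulate (adj G v)

  N[_] : Fin n → Subset n
  N[ v ] = N v ∪ ⁅ v ⁆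

ExactlyOne : {n : ℕ} → (Fin n → Set) → Set
ExactlyOne {n} P = Σ (Fin n) λ v → P v × (∀ w → P w → w ≡ v)

module _ {n : ℕ} (G : Graph n) where

  -- the sets N[v], v ∈ P, partition V(G): every vertex lies in exactly one of them
  IsECD : Subset n → Set
  IsECD P = ∀ u → ExactlyOne (λ v → v ∈ P × u ∈ N[_] G v)

  -- the sets N(v), v ∈ D, partition V(G)
  IsEOD : Subset n → Set
  IsEOD D = ∀ u → ExactlyOne (λ v → v ∈ D × u ∈ N G v)

  EOCDEmpty : Set
  EOCDEmpty = Σ (Subset n) λ P → Σ (Subset n) λ D →
    IsECD P × IsEOD D × Empty (D ∩ P)

  -- degree of v in the induced subgraph ⟨A⟩ (meaningful for v ∈ A)
  degIn : Subset n → Fin n → ℕ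
  degIn A v = ∣ A ∩ N G v ∣

P4Adj : Fin 4 → Fin 4 → Set
P4Adj a b = (toℕ a + 1 ≡ toℕ b) ⊎ (toℕ b + 1 ≡ toℕ a)

-- adjacency in kP4, vertex set Fin k × Fin 4 (copy index, position in path)
kP4Adj : {k : ℕ} → Fin k × Fin 4 → Fin k × Fin 4 → Set
kP4Adj (i Data.Product., a) (j Data.Product., b) = (i ≡ j) × P4Adj a b

module _ {n : ℕ} (G : Graph n) where

  InducedIsoKP4 : Subset n → Set
  InducedIsoKP4 A = Σ ℕ λ k → Σ (Fin k × Fin 4 → Fin n) λ φ →
    Injective _≡_ _≡_ φ ×
    (∀ v → (v ∈ A) ⇔ (∃ λ x → φ x ≡ v)) ×
    (∀ x y → (adj G (φ x) (φ y) ≡ true) ⇔ kP4Adj x y)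

  OutsideCondition : Subset n → Set
  OutsideCondition A = ∀ v → v ∉ A →
    ExactlyOne (λ u → u ∈ A × u ∈ N G v × degIn G A u ≡ 1) ×
    ExactlyOne (λ u → u ∈ A × u ∈ N G v × degIn G A u ≡ 2)

module Submission where

-- (⇐) Take P = the degree-1 vertices of ⟨A⟩ (path ends), D = the degree-2
-- vertices (path middles).  Inside a path every position is closed-dominated
-- by exactly one end (its nearest end) and openly dominated by exactly one
-- middle; outside A the two domination conditions are literally the outside
-- condition.
--
-- (⇒) Let π u ∈ P closed-dominate u and δ u ∈ D openly dominate u.  Every
-- p ∈ P starts an induced path p, δ p, δ δ p, q p := π (δ δ p); π maps each
-- path vertex to its nearest end and δ to its middle neighbour.  q is a
-- fixed-point-free involution of P, so choosing one representative of each
-- pair {p, q p} yields k disjoint paths whose union is A = P ∪ D.  In ⟨A⟩ the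
-- vertices of P have degree 1 and those of D degree 2, which again identifies
-- the domination conditions outside A with the outside condition.

open import Defs renaming (sym to adj-sym)
open import Data.Nat as ℕ using (ℕ)
open import Data.Bool using (Bool; true)
open import Data.Fin using (Fin; zero; suc; toℕ; _<_)
open import Data.Fin.Properties using (_<?_; <-cmp; <-asym; suc-injective)
open import Data.Fin.Subset
  using (Subset; _∈_; _∉_; _∩_; _∪_; _-_; ⁅_⁆; ∣_∣; Empty; inside; outside)
open import Data.Fin.Subset.Properties
  using ( _∈?_; ⊆-antisym; x∈⁅y⁆⇔x≡y; ∣⁅x⁆∣≡1; p─⊥≡p; x∈p∧x≢y⇒x∈p-y; p─q⊆p
        ; x∈p∪q⁺; x∈p∪q⁻; x∈p∩q⁺; x∈p∩q⁻)
open import Data.Vec using (_∷_; here; there; tabulate)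
open import Data.Vec.Properties using (lookup∘tabulate; []=⇒lookup; lookup⇒[]=)
open import Data.Product using (Σ; ∃; _×_; _,_; proj₁; proj₂)
open import Data.Sum using (_⊎_; inj₁; inj₂)
open import Data.Empty using (⊥-elim)
open import Relation.Nullary using (¬_; Dec; yes; no; does)
open import Relation.Nullary.Decidable using (_×-dec_; dec-true)
open import Relation.Binary.Definitions using (tri<; tri≈; tri>)
open import Relation.Binary.PropositionalEquality
  using (_≡_; _≢_; refl; sym; trans; cong; cong₂; subst; subst₂; module ≡-Reasoning)
open import Function.Base using (case_of_)
open import Function.Bundles using (_⇔_; mk⇔; Equivalence)
open import Function.Definitions using (Injective)
import Function.Properties.Equivalence as ⇔

open Equivalence using (to; from)

∈-tabulate⁺ : ∀ {n} (f : Fin n → Bool) {x} → f x ≡ true → x ∈ tabulate f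
∈-tabulate⁺ f {x} fx = lookup⇒[]= x (tabulate f) (trans (lookup∘tabulate f x) fx)

∈-tabulate⁻ : ∀ {n} (f : Fin n → Bool) {x} → x ∈ tabulate f → f x ≡ true
∈-tabulate⁻ f {x} x∈f = trans (sym (lookup∘tabulate f x)) ([]=⇒lookup x∈f)

subsetOf : ∀ {n} {P : Fin n → Set} → (∀ x → Dec (P x)) → Subset n
subsetOf P? = tabulate (λ x → does (P? x))

∈-subsetOf : ∀ {n} {P : Fin n → Set} (P? : ∀ x → Dec (P x)) {x} → x ∈ subsetOf P? ⇔ P x
∈-subsetOf P? {x} =
  mk⇔ (λ x∈ → witness (P? x) (∈-tabulate⁻ _ x∈)) (λ px → ∈-tabulate⁺ _ (dec-true (P? x) px))
  where
  witness : ∀ {A : Set} (A? : Dec A) → does A? ≡ true → A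
  witness (yes a) _ = a

card-singleton : ∀ {n} {s : Subset n} {a} → a ∈ s → (∀ {x} → x ∈ s → x ≡ a) → ∣ s ∣ ≡ 1
card-singleton {s = s} {a} a∈s only-a = subst (λ t → ∣ t ∣ ≡ 1) (sym s≡⁅a⁆) (∣⁅x⁆∣≡1 a)
  where
  s≡⁅a⁆ : s ≡ ⁅ a ⁆
  s≡⁅a⁆ = ⊆-antisym (λ x∈s → from x∈⁅y⁆⇔x≡y (only-a x∈s))
                    (λ x∈⁅a⁆ → subst (_∈ s) (sym (to x∈⁅y⁆⇔x≡y x∈⁅a⁆)) a∈s)

card-remove : ∀ {n} (s : Subset n) {a} → a ∈ s → ∣ s ∣ ≡ ℕ.suc ∣ s - a ∣
card-remove (inside ∷ s) here = cong (λ t → ℕ.suc ∣ t ∣) (sym (p─⊥≡p s))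
card-remove (inside ∷ s) (there a∈s) = cong ℕ.suc (card-remove s a∈s)
card-remove (outside ∷ s) (there a∈s) = card-remove s a∈s

x∉p-x : ∀ {n} (s : Subset n) x → x ∉ s - x
x∉p-x (_ ∷ s) zero ()
x∉p-x (_ ∷ s) (suc x) (there x∈) = x∉p-x s x x∈

card-pair : ∀ {n} {s : Subset n} {a b} → a ≢ b → a ∈ s → b ∈ s →
            (∀ {x} → x ∈ s → x ≡ a ⊎ x ≡ b) → ∣ s ∣ ≡ 2
card-pair {s = s} {a} {b} a≢b a∈s b∈s only-ab =
  trans (card-remove s a∈s) (cong ℕ.suc (card-singleton b∈s-a only-b))
  where
  b∈s-a : b ∈ s - a
  b∈s-a = x∈p∧x≢y⇒x∈p-y b∈s (λ b≡a → a≢b (sym b≡a))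
  only-b : ∀ {x} → x ∈ s - a → x ≡ b
  only-b {x} x∈ with only-ab (p─q⊆p s ⁅ a ⁆ x∈)
  ... | inj₁ refl = ⊥-elim (x∉p-x s a x∈)
  ... | inj₂ x≡b = x≡b

enumerate : ∀ {n} (s : Subset n) → Fin ∣ s ∣ → Fin n
enumerate (inside ∷ s) zero = zero
enumerate (inside ∷ s) (suc i) = suc (enumerate s i)
enumerate (outside ∷ s) i = suc (enumerate s i)

enumerate-∈ : ∀ {n} (s : Subset n) i → enumerate s i ∈ s
enumerate-∈ (inside ∷ s) zero = here
enumerate-∈ (inside ∷ s) (suc i) = there (enumerate-∈ s i)
enumerate-∈ (outside ∷ s) i = there (enumerate-∈ s i)

enumerate-injective : ∀ {n} (s : Subset n) → Injective _≡_ _≡_ (enumerate s)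
enumerate-injective (inside ∷ s) {zero} {zero} _ = refl
enumerate-injective (inside ∷ s) {suc i} {suc j} eq =
  cong suc (enumerate-injective s (suc-injective eq))
enumerate-injective (outside ∷ s) eq = enumerate-injective s (suc-injective eq)

enumerate-onto : ∀ {n} (s : Subset n) {x} → x ∈ s → ∃ λ i → enumerate s i ≡ x
enumerate-onto (inside ∷ s) here = zero , refl
enumerate-onto (inside ∷ s) (there x∈s) =
  let i , eq = enumerate-onto s x∈s in suc i , cong suc eq
enumerate-onto (outside ∷ s) (there x∈s) =
  let i , eq = enumerate-onto s x∈s in i , cong suc eq

-- Orbits of a fixed-point-free involution q on a subset S: the elements p of
-- S with p < q p form a set of representatives, one for each pair {p, q p}.
module Orbits {n} (S : Subset n) (q : Fin n → Fin n)
  (q-∈ : ∀ {p} → p ∈ S → q p ∈ S)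
  (q-involutive : ∀ {p} → p ∈ S → q (q p) ≡ p)
  (q-no-fixpoint : ∀ {p} → p ∈ S → q p ≢ p) where

  IsRepresentative : Fin n → Set
  IsRepresentative p = p ∈ S × p < q p

  isRepresentative? : ∀ p → Dec (IsRepresentative p)
  isRepresentative? p = (p ∈? S) ×-dec (p <? q p)

  Representatives : Subset n
  Representatives = subsetOf isRepresentative?

  count : ℕ
  count = ∣ Representatives ∣

  ∈-Representatives : ∀ {p} → p ∈ Representatives ⇔ IsRepresentative p
  ∈-Representatives = ∈-subsetOf isRepresentative?

  rep : Fin count → Fin n
  rep = enumerate Representatives

  rep-∈ : ∀ i → IsRepresentative (rep i)
  rep-∈ i = to ∈-Representatives (enumerate-∈ Representatives i)

  rep-injective : Injective _≡_ _≡_ rep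
  rep-injective = enumerate-injective Representatives

  rep-not-partner : ∀ i j → rep i ≢ q (rep j)
  rep-not-partner i j eq = <-asym (proj₂ (rep-∈ j)) qj<j
    where
    qi≡j : q (rep i) ≡ rep j
    qi≡j = trans (cong q eq) (q-involutive (proj₁ (rep-∈ j)))
    qj<j : q (rep j) < rep j
    qj<j = subst₂ _<_ eq qi≡j (proj₂ (rep-∈ i))

  covers : ∀ {p} → p ∈ S → ∃ λ i → rep i ≡ p ⊎ q (rep i) ≡ p
  covers {p} p∈S with <-cmp p (q p)
  ... | tri< p<qp _ _ =
    let i , eq = enumerate-onto Representatives (from ∈-Representatives (p∈S , p<qp))
    in i , inj₁ eq
  ... | tri≈ _ p≡qp _ = ⊥-elim (q-no-fixpoint p∈S (sym p≡qp))
  ... | tri> _ _ qp<p =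
    let qp<qqp = subst (q p <_) (sym (q-involutive p∈S)) qp<p
        i , eq = enumerate-onto Representatives (from ∈-Representatives (q-∈ p∈S , qp<qqp))
    in i , inj₂ (trans (cong q eq) (q-involutive p∈S))

ExactlyOne-cong : ∀ {n} {P Q : Fin n → Set} → (∀ w → P w ⇔ Q w) → ExactlyOne P → ExactlyOne Q
ExactlyOne-cong P⇔Q (v , Pv , unique) = v , to (P⇔Q v) Pv , λ w Qw → unique w (from (P⇔Q w) Qw)

module Adjacency {n} (G : Graph n) where

  E : Fin n → Fin n → Set
  E u v = adj G u v ≡ true

  E-sym : ∀ {u v} → E u v → E v u
  E-sym {u} {v} e = trans (adj-sym G v u) e

  E⇒≢ : ∀ {u v} → E u v → u ≢ v
  E⇒≢ {u} e refl with trans (sym (irrefl G u)) e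
  ... | ()

  ∈N⁺ : ∀ {v x} → E v x → x ∈ N G v
  ∈N⁺ {v} = ∈-tabulate⁺ (adj G v)

  ∈N⁻ : ∀ {v x} → x ∈ N G v → E v x
  ∈N⁻ {v} = ∈-tabulate⁻ (adj G v)

  ∈N[]⁺ : ∀ {v x} → E v x ⊎ x ≡ v → x ∈ N[_] G v
  ∈N[]⁺ (inj₁ e) = x∈p∪q⁺ (inj₁ (∈N⁺ e))
  ∈N[]⁺ (inj₂ x≡v) = x∈p∪q⁺ (inj₂ (from x∈⁅y⁆⇔x≡y x≡v))

  ∈N[]⁻ : ∀ {v x} → x ∈ N[_] G v → E v x ⊎ x ≡ v
  ∈N[]⁻ {v} x∈ with x∈p∪q⁻ (N G v) ⁅ v ⁆ x∈
  ... | inj₁ x∈N = inj₁ (∈N⁻ x∈N)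
  ... | inj₂ x∈⁅v⁆ = inj₂ (to x∈⁅y⁆⇔x≡y x∈⁅v⁆)

  ∈A∩N⁺ : ∀ {A v x} → x ∈ A → E v x → x ∈ A ∩ N G v
  ∈A∩N⁺ x∈A e = x∈p∩q⁺ (x∈A , ∈N⁺ e)

  ∈A∩N⁻ : ∀ {A v x} → x ∈ A ∩ N G v → x ∈ A × E v x
  ∈A∩N⁻ {A} {v} x∈ = let x∈A , x∈N = x∈p∩q⁻ A (N G v) x∈ in x∈A , ∈N⁻ x∈N

  module Dominators {A S : Subset n} {d : ℕ}
    (S-char : ∀ {w} → w ∈ S ⇔ (w ∈ A × degIn G A w ≡ d)) where

    open-dominators : ∀ v w → (w ∈ S × v ∈ N G w) ⇔ (w ∈ A × w ∈ N G v × degIn G A w ≡ d)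
    open-dominators v w = mk⇔
      (λ (w∈S , v∈Nw) → let w∈A , deg = to S-char w∈S in w∈A , flip-N v∈Nw , deg)
      (λ (w∈A , w∈Nv , deg) → from S-char (w∈A , deg) , flip-N w∈Nv)
      where
      flip-N : ∀ {x y} → x ∈ N G y → y ∈ N G x
      flip-N x∈Ny = ∈N⁺ (E-sym (∈N⁻ x∈Ny))

    closed-dominators : ∀ {v} → v ∉ A → ∀ w →
      (w ∈ S × v ∈ N[_] G w) ⇔ (w ∈ A × w ∈ N G v × degIn G A w ≡ d)
    closed-dominators {v} v∉A w = mk⇔
      (λ (w∈S , v∈N[w]) → to (open-dominators v w) (w∈S , open-part w∈S v∈N[w]))
      (λ h → let w∈S , v∈Nw = from (open-dominators v w) h in w∈S , ∈N[]⁺ (inj₁ (∈N⁻ v∈Nw)))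
      where
      open-part : w ∈ S → v ∈ N[_] G w → v ∈ N G w
      open-part w∈S v∈N[w] with ∈N[]⁻ v∈N[w]
      ... | inj₁ e = ∈N⁺ e
      ... | inj₂ refl = ⊥-elim (v∉A (proj₁ (to S-char w∈S)))

pattern 0F = zero
pattern 1F = suc zero
pattern 2F = suc (suc zero)
pattern 3F = suc (suc (suc zero))

-- The six oriented edges of P4 as an inductive family, so that case
-- analyses on adjacent positions range over the actual edges only.
data P4Edge : Fin 4 → Fin 4 → Set where
  0-1 : P4Edge 0F 1F
  1-0 : P4Edge 1F 0F
  1-2 : P4Edge 1F 2F
  2-1 : P4Edge 2F 1F
  2-3 : P4Edge 2F 3F
  3-2 : P4Edge 3F 2F

P4Edge-sym : ∀ {a b} → P4Edge a b → P4Edge b a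
P4Edge-sym 0-1 = 1-0
P4Edge-sym 1-0 = 0-1
P4Edge-sym 1-2 = 2-1
P4Edge-sym 2-1 = 1-2
P4Edge-sym 2-3 = 3-2
P4Edge-sym 3-2 = 2-3

P4Edge⇒P4Adj : ∀ {a b} → P4Edge a b → P4Adj a b
P4Edge⇒P4Adj 0-1 = inj₁ refl
P4Edge⇒P4Adj 1-0 = inj₂ refl
P4Edge⇒P4Adj 1-2 = inj₁ refl
P4Edge⇒P4Adj 2-1 = inj₂ refl
P4Edge⇒P4Adj 2-3 = inj₁ refl
P4Edge⇒P4Adj 3-2 = inj₂ refl

successor-edge : ∀ a b → toℕ a ℕ.+ 1 ≡ toℕ b → P4Edge a b
successor-edge 0F 1F _ = 0-1
successor-edge 1F 2F _ = 1-2
successor-edge 2F 3F _ = 2-3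
successor-edge 0F 0F ()
successor-edge 0F 2F ()
successor-edge 0F 3F ()
successor-edge 1F 0F ()
successor-edge 1F 1F ()
successor-edge 1F 3F ()
successor-edge 2F 0F ()
successor-edge 2F 1F ()
successor-edge 2F 2F ()
successor-edge 3F 0F ()
successor-edge 3F 1F ()
successor-edge 3F 2F ()
successor-edge 3F 3F ()

P4Adj⇒P4Edge : ∀ {a b} → P4Adj a b → P4Edge a b
P4Adj⇒P4Edge {a} {b} (inj₁ a+1≡b) = successor-edge a b a+1≡b
P4Adj⇒P4Edge {a} {b} (inj₂ b+1≡a) = P4Edge-sym (successor-edge b a b+1≡a)

p4deg : Fin 4 → ℕ
p4deg 0F = 1
p4deg 1F = 2
p4deg 2F = 2
p4deg 3F = 1

end-or-middle : ∀ a → p4deg a ≡ 1 ⊎ p4deg a ≡ 2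
end-or-middle 0F = inj₁ refl
end-or-middle 1F = inj₂ refl
end-or-middle 2F = inj₂ refl
end-or-middle 3F = inj₁ refl

-- The end of the path closest to a position (the closed dominator of a
-- position among the ends) ...
nearEnd : Fin 4 → Fin 4
nearEnd 0F = 0F
nearEnd 1F = 0F
nearEnd 2F = 3F
nearEnd 3F = 3F

-- ... and the unique middle adjacent to a position (its open dominator
-- among the middles).
middleNbr : Fin 4 → Fin 4
middleNbr 0F = 1F
middleNbr 1F = 2F
middleNbr 2F = 1F
middleNbr 3F = 2F

nearEnd-isEnd : ∀ a → p4deg (nearEnd a) ≡ 1
nearEnd-isEnd 0F = refl
nearEnd-isEnd 1F = refl
nearEnd-isEnd 2F = refl
nearEnd-isEnd 3F = refl

middleNbr-isMiddle : ∀ a → p4deg (middleNbr a) ≡ 2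
middleNbr-isMiddle 0F = refl
middleNbr-isMiddle 1F = refl
middleNbr-isMiddle 2F = refl
middleNbr-isMiddle 3F = refl

nearEnd-of-end : ∀ {a} → p4deg a ≡ 1 → nearEnd a ≡ a
nearEnd-of-end {0F} _ = refl
nearEnd-of-end {3F} _ = refl
nearEnd-of-end {1F} ()
nearEnd-of-end {2F} ()

nearEnd-of-middle : ∀ {a} → p4deg a ≡ 2 → P4Edge (nearEnd a) a
nearEnd-of-middle {1F} _ = 0-1
nearEnd-of-middle {2F} _ = 3-2
nearEnd-of-middle {0F} ()
nearEnd-of-middle {3F} ()

middleNbr-edge : ∀ a → P4Edge (middleNbr a) a
middleNbr-edge 0F = 1-0
middleNbr-edge 1F = 2-1
middleNbr-edge 2F = 1-2
middleNbr-edge 3F = 2-3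

nearEnd-unique : ∀ {a b} → p4deg b ≡ 1 → P4Edge b a → b ≡ nearEnd a
nearEnd-unique _ 0-1 = refl
nearEnd-unique _ 3-2 = refl

middleNbr-unique : ∀ {a b} → p4deg b ≡ 2 → P4Edge b a → b ≡ middleNbr a
middleNbr-unique _ 1-0 = refl
middleNbr-unique _ 1-2 = refl
middleNbr-unique _ 2-1 = refl
middleNbr-unique _ 2-3 = refl

position-determined : ∀ {a b} → nearEnd a ≡ nearEnd b → p4deg a ≡ p4deg b → a ≡ b
position-determined {a} {b} ends degs =
  trans (sym (decode-position a)) (trans (cong₂ decode ends degs) (decode-position b))
  where
  decode : Fin 4 → ℕ → Fin 4
  decode 0F 1 = 0F
  decode 0F _ = 1F
  decode _  1 = 3F
  decode _  _ = 2F
  decode-position : ∀ a → decode (nearEnd a) (p4deg a) ≡ a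
  decode-position 0F = refl
  decode-position 1F = refl
  decode-position 2F = refl
  decode-position 3F = refl

module FromInducedPaths {n} (G : Graph n) (A : Subset n) (k : ℕ) (φ : Fin k × Fin 4 → Fin n)
  (φ-injective : Injective _≡_ _≡_ φ) (φ-image : ∀ v → (v ∈ A) ⇔ (∃ λ x → φ x ≡ v))
  (φ-adj : ∀ x y → (adj G (φ x) (φ y) ≡ true) ⇔ kP4Adj x y)
  (beyond-A : OutsideCondition G A) where

  open Adjacency G

  φ-∈A : ∀ x → φ x ∈ A
  φ-∈A x = from (φ-image (φ x)) (x , refl)

  φ-edge : ∀ {i a b} → P4Edge a b → E (φ (i , a)) (φ (i , b))
  φ-edge {i} {a} {b} ab = from (φ-adj (i , a) (i , b)) (refl , P4Edge⇒P4Adj ab)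

  φ-reflects-edge : ∀ {i a j b} → E (φ (i , a)) (φ (j , b)) → i ≡ j × P4Edge a b
  φ-reflects-edge {i} {a} {j} {b} e =
    let i≡j , ab = to (φ-adj (i , a) (j , b)) e in i≡j , P4Adj⇒P4Edge ab

  neighbour-∈ : ∀ {i a b} → P4Edge a b → φ (i , b) ∈ A ∩ N G (φ (i , a))
  neighbour-∈ ab = ∈A∩N⁺ (φ-∈A _) (φ-edge ab)

  neighbours-in-copy : ∀ {i a x} → x ∈ A ∩ N G (φ (i , a)) → ∃ λ b → P4Edge a b × x ≡ φ (i , b)
  neighbours-in-copy x∈ with ∈A∩N⁻ x∈
  ... | x∈A , e with to (φ-image _) x∈A
  ... | (j , b) , refl with φ-reflects-edge e
  ... | refl , ab = b , ab , refl

  deg-φ : ∀ i a → degIn G A (φ (i , a)) ≡ p4deg a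
  deg-φ i 0F = card-singleton (neighbour-∈ 0-1)
    (λ x∈ → case neighbours-in-copy x∈ of λ { (_ , 0-1 , x≡) → x≡ })
  deg-φ i 1F = card-pair (λ eq → case φ-injective eq of λ ()) (neighbour-∈ 1-0) (neighbour-∈ 1-2)
    (λ x∈ → case neighbours-in-copy x∈ of λ
      { (_ , 1-0 , x≡) → inj₁ x≡
      ; (_ , 1-2 , x≡) → inj₂ x≡ })
  deg-φ i 2F = card-pair (λ eq → case φ-injective eq of λ ()) (neighbour-∈ 2-1) (neighbour-∈ 2-3)
    (λ x∈ → case neighbours-in-copy x∈ of λ
      { (_ , 2-1 , x≡) → inj₁ x≡
      ; (_ , 2-3 , x≡) → inj₂ x≡ })
  deg-φ i 3F = card-singleton (neighbour-∈ 3-2)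
    (λ x∈ → case neighbours-in-copy x∈ of λ { (_ , 3-2 , x≡) → x≡ })

  position-of-degree : ∀ {w d} → w ∈ A → degIn G A w ≡ d →
                       ∃ λ x → φ x ≡ w × p4deg (proj₂ x) ≡ d
  position-of-degree w∈A deg with to (φ-image _) w∈A
  ... | (j , b) , refl = (j , b) , refl , trans (sym (deg-φ j b)) deg

  ofDegree? : ∀ d v → Dec (v ∈ A × degIn G A v ≡ d)
  ofDegree? d v = (v ∈? A) ×-dec (degIn G A v ℕ.≟ d)

  OfDegree : ℕ → Subset n
  OfDegree d = subsetOf (ofDegree? d)

  ∈-OfDegree : ∀ {d v} → v ∈ OfDegree d ⇔ (v ∈ A × degIn G A v ≡ d)
  ∈-OfDegree {d} = ∈-subsetOf (ofDegree? d)

  P D : Subset n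
  P = OfDegree 1
  D = OfDegree 2

  φ-∈-OfDegree : ∀ {d i a} → p4deg a ≡ d → φ (i , a) ∈ OfDegree d
  φ-∈-OfDegree {d} {i} {a} deg = from ∈-OfDegree (φ-∈A _ , trans (deg-φ i a) deg)

  closed-dominator : ∀ i a → ExactlyOne (λ w → w ∈ P × φ (i , a) ∈ N[_] G w)
  closed-dominator i a =
    φ (i , nearEnd a) , (φ-∈-OfDegree (nearEnd-isEnd a) , ∈N[]⁺ near) , unique
    where
    near : E (φ (i , nearEnd a)) (φ (i , a)) ⊎ φ (i , a) ≡ φ (i , nearEnd a)
    near with end-or-middle a
    ... | inj₁ end = inj₂ (cong (λ c → φ (i , c)) (sym (nearEnd-of-end end)))
    ... | inj₂ mid = inj₁ (φ-edge (nearEnd-of-middle mid))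
    unique : ∀ w → w ∈ P × φ (i , a) ∈ N[_] G w → w ≡ φ (i , nearEnd a)
    unique w (w∈P , u∈N[w]) with to ∈-OfDegree w∈P
    ... | w∈A , deg with position-of-degree w∈A deg
    ... | (j , b) , refl , end with ∈N[]⁻ u∈N[w]
    ... | inj₁ e = let j≡i , ba = φ-reflects-edge e in cong φ (cong₂ _,_ j≡i (nearEnd-unique end ba))
    ... | inj₂ eq with φ-injective eq
    ... | refl = cong (λ c → φ (i , c)) (sym (nearEnd-of-end end))

  open-dominator : ∀ i a → ExactlyOne (λ w → w ∈ D × φ (i , a) ∈ N G w)
  open-dominator i a =
    φ (i , middleNbr a) ,
    (φ-∈-OfDegree (middleNbr-isMiddle a) , ∈N⁺ (φ-edge (middleNbr-edge a))) , unique
    where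
    unique : ∀ w → w ∈ D × φ (i , a) ∈ N G w → w ≡ φ (i , middleNbr a)
    unique w (w∈D , u∈Nw) with to ∈-OfDegree w∈D
    ... | w∈A , deg with position-of-degree w∈A deg
    ... | (j , b) , refl , mid =
      let j≡i , ba = φ-reflects-edge (∈N⁻ u∈Nw) in cong φ (cong₂ _,_ j≡i (middleNbr-unique mid ba))

  P-ECD : IsECD G P
  P-ECD u with u ∈? A
  ... | no u∉A =
    ExactlyOne-cong (λ w → ⇔.sym (Dominators.closed-dominators ∈-OfDegree u∉A w)) (proj₁ (beyond-A u u∉A))
  ... | yes u∈A with to (φ-image u) u∈A
  ... | (i , a) , refl = closed-dominator i a

  D-EOD : IsEOD G D
  D-EOD u with u ∈? A
  ... | no u∉A =
    ExactlyOne-cong (λ w → ⇔.sym (Dominators.open-dominators ∈-OfDegree u w)) (proj₂ (beyond-A u u∉A))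
  ... | yes u∈A with to (φ-image u) u∈A
  ... | (i , a) , refl = open-dominator i a

  D∩P-empty : Empty (D ∩ P)
  D∩P-empty (x , x∈D∩P) with x∈p∩q⁻ D P x∈D∩P
  ... | x∈D , x∈P with trans (sym (proj₂ (to ∈-OfDegree x∈D))) (proj₂ (to ∈-OfDegree x∈P))
  ... | ()

  eocd : EOCDEmpty G
  eocd = P , D , P-ECD , D-EOD , D∩P-empty

module FromDomination {n} (G : Graph n) (P D : Subset n)
  (P-ECD : IsECD G P) (D-EOD : IsEOD G D) (D∩P-empty : Empty (D ∩ P)) where

  open Adjacency G

  π δ : Fin n → Fin n
  π u = proj₁ (P-ECD u)
  δ u = proj₁ (D-EOD u)

  π-∈ : ∀ u → π u ∈ P
  π-∈ u = proj₁ (proj₁ (proj₂ (P-ECD u)))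

  π-unique : ∀ {u v} → v ∈ P → u ∈ N[_] G v → v ≡ π u
  π-unique {u} {v} v∈P u∈N[v] = proj₂ (proj₂ (P-ECD u)) v (v∈P , u∈N[v])

  δ-∈ : ∀ u → δ u ∈ D
  δ-∈ u = proj₁ (proj₁ (proj₂ (D-EOD u)))

  δ-adj : ∀ u → E (δ u) u
  δ-adj u = ∈N⁻ (proj₂ (proj₁ (proj₂ (D-EOD u))))

  δ-unique : ∀ {u v} → v ∈ D → E v u → v ≡ δ u
  δ-unique {u} {v} v∈D e = proj₂ (proj₂ (D-EOD u)) v (v∈D , ∈N⁺ e)

  P-not-D : ∀ {x} → x ∈ P → x ∉ D
  P-not-D {x} x∈P x∈D = D∩P-empty (x , x∈p∩q⁺ (x∈D , x∈P))

  π-of-P : ∀ {p} → p ∈ P → π p ≡ p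
  π-of-P p∈P = sym (π-unique p∈P (∈N[]⁺ (inj₂ refl)))

  π-of-neighbour : ∀ {p v} → p ∈ P → E p v → π v ≡ p
  π-of-neighbour p∈P e = sym (π-unique p∈P (∈N[]⁺ (inj₁ e)))

  δ-of-neighbour : ∀ {d v} → d ∈ D → E d v → δ v ≡ d
  δ-of-neighbour d∈D e = sym (δ-unique d∈D e)

  π-adj : ∀ {u} → u ∉ P → E (π u) u
  π-adj {u} u∉P with ∈N[]⁻ (proj₂ (proj₁ (proj₂ (P-ECD u))))
  ... | inj₁ e = e
  ... | inj₂ u≡πu = ⊥-elim (u∉P (subst (_∈ P) (sym u≡πu) (π-∈ u)))

  -- P is independent: two adjacent vertices of P would closed-dominate each other
  P-independent : ∀ {p p′} → p ∈ P → p′ ∈ P → ¬ E p p′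
  P-independent p∈P p′∈P e = E⇒≢ e (trans (sym (π-of-neighbour p∈P e)) (π-of-P p′∈P))

  A : Subset n
  A = P ∪ D

  degree-P : ∀ {p} → p ∈ P → degIn G A p ≡ 1
  degree-P {p} p∈P = card-singleton (∈A∩N⁺ (x∈p∪q⁺ (inj₂ (δ-∈ p))) (E-sym (δ-adj p))) only-δ
    where
    only-δ : ∀ {x} → x ∈ A ∩ N G p → x ≡ δ p
    only-δ x∈ with ∈A∩N⁻ x∈
    ... | x∈A , e with x∈p∪q⁻ P D x∈A
    ... | inj₁ x∈P = ⊥-elim (P-independent p∈P x∈P e)
    ... | inj₂ x∈D = δ-unique x∈D (E-sym e)

  degree-D : ∀ {d} → d ∈ D → degIn G A d ≡ 2
  degree-D {d} d∈D = card-pair (λ eq → P-not-D (π-∈ d) (subst (_∈ D) (sym eq) (δ-∈ d)))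
    (∈A∩N⁺ (x∈p∪q⁺ (inj₁ (π-∈ d))) (E-sym (π-adj (λ d∈P → P-not-D d∈P d∈D))))
    (∈A∩N⁺ (x∈p∪q⁺ (inj₂ (δ-∈ d))) (E-sym (δ-adj d))) only-πδ
    where
    only-πδ : ∀ {x} → x ∈ A ∩ N G d → x ≡ π d ⊎ x ≡ δ d
    only-πδ x∈ with ∈A∩N⁻ x∈
    ... | x∈A , e with x∈p∪q⁻ P D x∈A
    ... | inj₁ x∈P = inj₁ (π-unique x∈P (∈N[]⁺ (inj₁ (E-sym e))))
    ... | inj₂ x∈D = inj₂ (δ-unique x∈D (E-sym e))

  P-char : ∀ {w} → w ∈ P ⇔ (w ∈ A × degIn G A w ≡ 1)
  P-char = mk⇔ (λ w∈P → x∈p∪q⁺ (inj₁ w∈P) , degree-P w∈P) of-degree-1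
    where
    of-degree-1 : ∀ {w} → w ∈ A × degIn G A w ≡ 1 → w ∈ P
    of-degree-1 (w∈A , deg) with x∈p∪q⁻ P D w∈A
    ... | inj₁ w∈P = w∈P
    ... | inj₂ w∈D with trans (sym (degree-D w∈D)) deg
    ... | ()

  D-char : ∀ {w} → w ∈ D ⇔ (w ∈ A × degIn G A w ≡ 2)
  D-char = mk⇔ (λ w∈D → x∈p∪q⁺ (inj₂ w∈D) , degree-D w∈D) of-degree-2
    where
    of-degree-2 : ∀ {w} → w ∈ A × degIn G A w ≡ 2 → w ∈ D
    of-degree-2 (w∈A , deg) with x∈p∪q⁻ P D w∈A
    ... | inj₂ w∈D = w∈D
    ... | inj₁ w∈P with trans (sym (degree-P w∈P)) deg
    ... | ()

  path : Fin n → Fin 4 → Fin n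
  path p 0F = p
  path p 1F = δ p
  path p 2F = δ (δ p)
  path p 3F = π (δ (δ p))

  q : Fin n → Fin n
  q p = path p 3F

  path-kind : ∀ {p} → p ∈ P → ∀ a → (p4deg a ≡ 1 × path p a ∈ P) ⊎ (p4deg a ≡ 2 × path p a ∈ D)
  path-kind p∈P 0F = inj₁ (refl , p∈P)
  path-kind p∈P 1F = inj₂ (refl , δ-∈ _)
  path-kind p∈P 2F = inj₂ (refl , δ-∈ _)
  path-kind p∈P 3F = inj₁ (refl , π-∈ _)

  deg-path : ∀ {p} → p ∈ P → ∀ a → degIn G A (path p a) ≡ p4deg a
  deg-path p∈P a with path-kind p∈P a
  ... | inj₁ (end , v∈P) = trans (degree-P v∈P) (sym end)
  ... | inj₂ (mid , v∈D) = trans (degree-D v∈D) (sym mid)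

  π-on-path : ∀ {p} → p ∈ P → ∀ a → π (path p a) ≡ path p (nearEnd a)
  π-on-path p∈P 0F = π-of-P p∈P
  π-on-path p∈P 1F = π-of-neighbour p∈P (E-sym (δ-adj _))
  π-on-path p∈P 2F = refl
  π-on-path p∈P 3F = π-of-P (π-∈ _)

  δ-on-path : ∀ {p} → p ∈ P → ∀ a → δ (path p a) ≡ path p (middleNbr a)
  δ-on-path p∈P 0F = refl
  δ-on-path p∈P 1F = refl
  δ-on-path p∈P 2F = δ-of-neighbour (δ-∈ _) (E-sym (δ-adj _))
  δ-on-path p∈P 3F = δ-of-neighbour (δ-∈ _) (E-sym (π-adj (λ x∈P → P-not-D x∈P (δ-∈ _))))

  middle-edge : ∀ {p} → p ∈ P → ∀ a → E (path p (middleNbr a)) (path p a)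
  middle-edge {p} p∈P a = subst (λ x → E x (path p a)) (δ-on-path p∈P a) (δ-adj (path p a))

  path-edge : ∀ {p a b} → p ∈ P → P4Edge a b → E (path p a) (path p b)
  path-edge p∈P 0-1 = E-sym (middle-edge p∈P 0F)
  path-edge p∈P 1-0 = middle-edge p∈P 0F
  path-edge p∈P 1-2 = middle-edge p∈P 2F
  path-edge p∈P 2-1 = middle-edge p∈P 1F
  path-edge p∈P 2-3 = middle-edge p∈P 3F
  path-edge p∈P 3-2 = E-sym (middle-edge p∈P 3F)

  q-involutive : ∀ {p} → p ∈ P → q (q p) ≡ p
  q-involutive {p} p∈P = begin
    π (δ (δ (q p)))         ≡⟨ cong (λ x → π (δ x)) (δ-on-path p∈P 3F) ⟩
    π (δ (path p 2F))       ≡⟨ cong π (δ-on-path p∈P 2F) ⟩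
    π (path p 1F)           ≡⟨ π-on-path p∈P 1F ⟩
    p                       ∎
    where open ≡-Reasoning

  -- q p = p would make the adjacent middles δ p and δ δ p equal
  q-no-fixpoint : ∀ {p} → p ∈ P → q p ≢ p
  q-no-fixpoint {p} p∈P qp≡p = E⇒≢ (path-edge p∈P 1-2) (sym middles-equal)
    where
    middles-equal : path p 2F ≡ path p 1F
    middles-equal = trans (sym (δ-on-path p∈P 3F)) (cong δ qp≡p)

  q-∈ : ∀ {p} → p ∈ P → q p ∈ P
  q-∈ {p} _ = π-∈ (path p 2F)

  open Orbits P q q-∈ q-involutive q-no-fixpoint

  φ : Fin count × Fin 4 → Fin n
  φ (i , a) = path (rep i) a

  rep-P : ∀ i → rep i ∈ P
  rep-P i = proj₁ (rep-∈ i)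

  ends-determined : ∀ {i j c c′} → p4deg c ≡ 1 → p4deg c′ ≡ 1 →
                    φ (i , c) ≡ φ (j , c′) → i ≡ j × c ≡ c′
  ends-determined {c = 0F} {0F} _ _ eq = rep-injective eq , refl
  ends-determined {i} {j} {0F} {3F} _ _ eq = ⊥-elim (rep-not-partner i j eq)
  ends-determined {i} {j} {3F} {0F} _ _ eq = ⊥-elim (rep-not-partner j i (sym eq))
  ends-determined {i} {j} {3F} {3F} _ _ eq = rep-injective partners-equal , refl
    where
    partners-equal : rep i ≡ rep j
    partners-equal = trans (sym (q-involutive (rep-P i))) (trans (cong q eq) (q-involutive (rep-P j)))

  -- a vertex on the chosen paths determines its copy and position: apply π
  -- to find the end, and compare degrees in A
  φ-injective : Injective _≡_ _≡_ φ
  φ-injective {i , a} {j , b} eq =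
    conclude (ends-determined (nearEnd-isEnd a) (nearEnd-isEnd b) ends-equal)
    where
    ends-equal : φ (i , nearEnd a) ≡ φ (j , nearEnd b)
    ends-equal = trans (sym (π-on-path (rep-P i) a)) (trans (cong π eq) (π-on-path (rep-P j) b))
    degrees : p4deg a ≡ p4deg b
    degrees = trans (sym (deg-path (rep-P i) a)) (trans (cong (degIn G A) eq) (deg-path (rep-P j) b))
    conclude : i ≡ j × nearEnd a ≡ nearEnd b → (i , a) ≡ (j , b)
    conclude (refl , ends) = cong (i ,_) (position-determined ends degrees)

  φ-preserves-adj : ∀ x y → kP4Adj x y → E (φ x) (φ y)
  φ-preserves-adj (i , a) (.i , b) (refl , ab) = path-edge (rep-P i) (P4Adj⇒P4Edge ab)

  end-neighbour : ∀ {i j : Fin count} {a b} → p4deg a ≡ 1 → p4deg b ≡ 2 →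
                  φ (j , nearEnd b) ≡ φ (i , a) → kP4Adj (i , a) (j , b)
  end-neighbour {b = b} a-end b-mid eq with ends-determined (nearEnd-isEnd b) a-end eq
  ... | refl , refl = refl , P4Edge⇒P4Adj (nearEnd-of-middle b-mid)

  middle-neighbour : ∀ {i j : Fin count} {a b} → (j , middleNbr b) ≡ (i , a) → kP4Adj (i , a) (j , b)
  middle-neighbour {b = b} refl = refl , P4Edge⇒P4Adj (middleNbr-edge b)

  -- an edge between chosen path vertices lies along a path: seen from an
  -- end it is found by π, seen from a middle by δ
  φ-reflects-adj : ∀ x y → E (φ x) (φ y) → kP4Adj x y
  φ-reflects-adj (i , a) (j , b) e with path-kind (rep-P i) a | path-kind (rep-P j) b
  ... | inj₁ (_ , u∈P) | inj₁ (_ , v∈P) = ⊥-elim (P-independent u∈P v∈P e)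
  ... | inj₁ (a-end , u∈P) | inj₂ (b-mid , _) =
    end-neighbour a-end b-mid (trans (sym (π-on-path (rep-P j) b)) (π-of-neighbour u∈P e))
  ... | inj₂ (_ , u∈D) | _ =
    middle-neighbour (φ-injective (trans (sym (δ-on-path (rep-P j) b)) (δ-of-neighbour u∈D e)))

  P-covered : ∀ {p} → p ∈ P → ∃ λ i → ∃ λ c → p4deg c ≡ 1 × φ (i , c) ≡ p
  P-covered p∈P with covers p∈P
  ... | i , inj₁ rep≡p = i , 0F , refl , rep≡p
  ... | i , inj₂ partner≡p = i , 3F , refl , partner≡p

  A-covered : ∀ {v} → v ∈ A → ∃ λ x → φ x ≡ v
  A-covered {v} v∈A with x∈p∪q⁻ P D v∈A
  ... | inj₁ v∈P = let i , c , _ , eq = P-covered v∈P in (i , c) , eq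
  ... | inj₂ v∈D =
    let i , c , _ , eq = P-covered (π-∈ v)
        v-next-to-πv = δ-of-neighbour v∈D (E-sym (π-adj (λ v∈P → P-not-D v∈P v∈D)))
    in (i , middleNbr c) , trans (sym (δ-on-path (rep-P i) c)) (trans (cong δ eq) v-next-to-πv)

  φ-image : ∀ v → (v ∈ A) ⇔ (∃ λ x → φ x ≡ v)
  φ-image v = mk⇔ A-covered λ { ((i , a) , refl) → path-∈A (path-kind (rep-P i) a) }
    where
    path-∈A : ∀ {a w} → (p4deg a ≡ 1 × w ∈ P) ⊎ (p4deg a ≡ 2 × w ∈ D) → w ∈ A
    path-∈A (inj₁ (_ , w∈P)) = x∈p∪q⁺ (inj₁ w∈P)
    path-∈A (inj₂ (_ , w∈D)) = x∈p∪q⁺ (inj₂ w∈D)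

  induced-kP4 : InducedIsoKP4 G A
  induced-kP4 = count , φ , φ-injective , φ-image ,
                λ x y → mk⇔ (φ-reflects-adj x y) (φ-preserves-adj x y)

  outside-condition : OutsideCondition G A
  outside-condition v v∉A =
    ExactlyOne-cong (Dominators.closed-dominators P-char v∉A) (P-ECD v) ,
    ExactlyOne-cong (Dominators.open-dominators D-char v) (D-EOD v)

proposition2p1 : (n : ℕ) (G : Graph n) →
    EOCDEmpty G ⇔ Σ (Subset n) (λ A → InducedIsoKP4 G A × OutsideCondition G A)
proposition2p1 n G = mk⇔
  (λ (P , D , P-ECD , D-EOD , D∩P-empty) →
    let open FromDomination G P D P-ECD D-EOD D∩P-empty in A , induced-kP4 , outside-condition)
  (λ (A , (k , φ , φ-injective , φ-image , φ-adj) , beyond-A) →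
    FromInducedPaths.eocd G A k φ φ-injective φ-image φ-adj beyond-A)
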